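{- Let $1 \le t_1 < \cdots < t_k < n$ be integers and $G = G_n\langle t_1, \ldots, t_k\rangle$. Then $G$ is triangle-free if and only if $|t_i - t_j| \notin \{t_1, \ldots, t_k\}$ for every pair $i, j \in \{1, \ldots, k\}$.
   Context: For integers $1 \le t_1 < \cdots < t_k < n$, the Toeplitz graph $G_n\langle t_1, \ldots, t_k\rangle$ is the simple graph with vertex set $\{1, \ldots, n\}$ in which distinct vertices $i,j$ are adjacent iff $|i-j| \in \{t_1, \ldots, t_k\}$. -}

module Defs where

open import Data.Nat using (ℕ; _<_; _≤_; ∣_-_∣)
open import Data.Fin using (Fin)
open import Data.Product using (_×_; ∃; ∃-syntax)
open import Relation.Binary.PropositionalEquality using (_≡_)
open import Relation.Nullary using (¬_)

-- Generator sequence t₁ < ⋯ < t_k (indexed by Fin k), with 1 ≤ t₁ and t_k < n.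
-- Since t is strictly increasing, we require 1 ≤ t l and t l < n for all l.
IsToeplitzSeq : (n k : ℕ) → (Fin k → ℕ) → Set
IsToeplitzSeq n k t =
  (∀ {i j : Fin k} → Data.Fin._<_ i j → t i < t j) ×
  (∀ (l : Fin k) → 1 ≤ t l × t l < n)

IsVertex : ℕ → ℕ → Set
IsVertex n v = 1 ≤ v × v ≤ n

InGen : {k : ℕ} → (Fin k → ℕ) → ℕ → Set
InGen {k} t d = ∃[ l ] d ≡ t l

Adj : {k : ℕ} → (Fin k → ℕ) → ℕ → ℕ → Set
Adj t i j = ¬ (i ≡ j) × InGen t ∣ i - j ∣

TriangleFree : (n : ℕ) {k : ℕ} → (Fin k → ℕ) → Set
TriangleFree n t =
  ∀ a b c → IsVertex n a → IsVertex n b → IsVertex n c →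
  ¬ (Adj t a b × Adj t b c × Adj t a c)

{-# OPTIONS --safe #-}
-- The differences of a triangle a < b < c in a Toeplitz graph are generators
-- t_p = b − a, t_q = c − b, t_r = c − a with t_r − t_p = t_q, so a triangle
-- yields two generators whose difference is again a generator. Conversely, if
-- ∣t_i − t_j∣ = t_l then 1, 1 + t_i, 1 + t_j is a triangle.
module Submission where

open import Defs
open import Data.Nat using (ℕ; _+_; _≤_; _<_; ∣_-_∣; z≤n; s≤s)
open import Data.Nat.Properties
  using (+-comm; ≤-total; ≤-trans; ∣-∣-comm; m≡n⇒∣m-n∣≡0; m≤n⇒∣m-n∣≡n∸m; m+[n∸m]≡n; ∣m-m+n∣≡n)
open import Data.Fin using (Fin)
open import Data.Product using (_×_; _,_; proj₁; proj₂)
open import Data.Sum using (_⊎_; inj₁; inj₂)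
open import Relation.Nullary using (¬_)
open import Relation.Binary.PropositionalEquality
  using (_≡_; sym; trans; cong; cong₂; subst; module ≡-Reasoning)
open import Function.Bundles using (_⇔_; mk⇔)

Between : ℕ → ℕ → ℕ → Set
Between a b c = ∣ a - b ∣ + ∣ b - c ∣ ≡ ∣ a - c ∣

≤-between : ∀ {a b c} → a ≤ b → b ≤ c → Between a b c
≤-between {b = b} z≤n b≤c = trans (cong (b +_) (m≤n⇒∣m-n∣≡n∸m b≤c)) (m+[n∸m]≡n b≤c)
≤-between (s≤s a≤b) (s≤s b≤c) = ≤-between a≤b b≤c

between-sym : ∀ {a b c} → Between a b c → Between c b a
between-sym {a} {b} {c} a-b-c = begin
  ∣ c - b ∣ + ∣ b - a ∣ ≡⟨ cong₂ _+_ (∣-∣-comm c b) (∣-∣-comm b a) ⟩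
  ∣ b - c ∣ + ∣ a - b ∣ ≡⟨ +-comm ∣ b - c ∣ ∣ a - b ∣ ⟩
  ∣ a - b ∣ + ∣ b - c ∣ ≡⟨ a-b-c ⟩
  ∣ a - c ∣             ≡⟨ ∣-∣-comm a c ⟩
  ∣ c - a ∣             ∎
  where open ≡-Reasoning

some-between : ∀ a b c → Between a b c ⊎ Between b a c ⊎ Between a c b
some-between a b c with ≤-total a b | ≤-total b c | ≤-total a c
... | inj₁ a≤b | inj₁ b≤c | _        = inj₁ (≤-between a≤b b≤c)
... | inj₁ a≤b | inj₂ c≤b | inj₁ a≤c = inj₂ (inj₂ (≤-between a≤c c≤b))
... | inj₁ a≤b | inj₂ c≤b | inj₂ c≤a = inj₂ (inj₁ (between-sym {c} (≤-between c≤a a≤b)))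
... | inj₂ b≤a | inj₁ b≤c | inj₁ a≤c = inj₂ (inj₁ (≤-between b≤a a≤c))
... | inj₂ b≤a | inj₁ b≤c | inj₂ c≤a = inj₂ (inj₂ (between-sym {b} (≤-between b≤c c≤a)))
... | inj₂ b≤a | inj₂ c≤b | _        = inj₁ (between-sym {c} (≤-between c≤b b≤a))

module _ {k : ℕ} (t : Fin k → ℕ) where

  inGen-∣-∣-comm : ∀ {a b} → InGen t ∣ a - b ∣ → InGen t ∣ b - a ∣
  inGen-∣-∣-comm {a} {b} = subst (InGen t) (∣-∣-comm a b)

  inGen⇒adj : ¬ InGen t 0 → ∀ {a b} → InGen t ∣ a - b ∣ → Adj t a b
  inGen⇒adj ¬gen0 gen = (λ a≡b → ¬gen0 (subst (InGen t) (m≡n⇒∣m-n∣≡0 a≡b) gen)) , gen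

  GeneratorDifferenceFree : Set
  GeneratorDifferenceFree = ∀ (i j : Fin k) → ¬ InGen t ∣ t i - t j ∣

  between-gens⇒¬differenceFree : ∀ {a b c} → Between a b c →
    InGen t ∣ a - b ∣ → InGen t ∣ b - c ∣ → InGen t ∣ a - c ∣ →
    ¬ GeneratorDifferenceFree
  between-gens⇒¬differenceFree a-b-c (p , ab≡tp) (q , bc≡tq) (r , ac≡tr) free =
    free r p (q , ∣tr-tp∣≡tq)
    where
    open ≡-Reasoning
    tr≡tp+tq : t r ≡ t p + t q
    tr≡tp+tq = trans (sym ac≡tr) (trans (sym a-b-c) (cong₂ _+_ ab≡tp bc≡tq))
    ∣tr-tp∣≡tq : ∣ t r - t p ∣ ≡ t q
    ∣tr-tp∣≡tq = begin
      ∣ t r - t p ∣        ≡⟨ cong (λ m → ∣ m - t p ∣) tr≡tp+tq ⟩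
      ∣ t p + t q - t p ∣  ≡⟨ ∣-∣-comm (t p + t q) (t p) ⟩
      ∣ t p - t p + t q ∣  ≡⟨ ∣m-m+n∣≡n (t p) (t q) ⟩
      t q                  ∎

  differenceFree⇒triangleFree : ∀ n → GeneratorDifferenceFree → TriangleFree n t
  differenceFree⇒triangleFree n free a b c _ _ _ ((_ , ab) , (_ , bc) , (_ , ac))
    with some-between a b c
  ... | inj₁ a-b-c        = between-gens⇒¬differenceFree {a} {b} {c} a-b-c ab bc ac free
  ... | inj₂ (inj₁ b-a-c) =
    between-gens⇒¬differenceFree {b} {a} {c} b-a-c (inGen-∣-∣-comm {a} ab) ac bc free
  ... | inj₂ (inj₂ a-c-b) =
    between-gens⇒¬differenceFree {a} {c} {b} a-c-b ac (inGen-∣-∣-comm {b} bc) ab free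

  triangleFree⇒differenceFree : ∀ n → (∀ l → 1 ≤ t l × t l < n) →
    TriangleFree n t → GeneratorDifferenceFree
  triangleFree⇒differenceFree n bounds triangleFree i j ti-tj =
    triangleFree 1 (1 + t i) (1 + t j)
      (s≤s z≤n , ≤-trans (s≤s z≤n) (proj₂ (bounds i)))
      (s≤s z≤n , proj₂ (bounds i))
      (s≤s z≤n , proj₂ (bounds j))
      ( inGen⇒adj ¬gen0 (i , ∣m-m+n∣≡n 1 (t i))
      , inGen⇒adj ¬gen0 ti-tj
      , inGen⇒adj ¬gen0 (j , ∣m-m+n∣≡n 1 (t j)) )
    where
    ¬gen0 : ¬ InGen t 0
    ¬gen0 (l , 0≡tl) with () ← subst (1 ≤_) (sym 0≡tl) (proj₁ (bounds l))

corollary6 : (n k : ℕ) (t : Fin k → ℕ) → IsToeplitzSeq n k t →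
    TriangleFree n t ⇔ (∀ (i j : Fin k) → ¬ InGen t ∣ t i - t j ∣)
corollary6 n k t (_ , bounds) =
  mk⇔ (triangleFree⇒differenceFree t n bounds) (differenceFree⇒triangleFree t n)
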